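{- Let $D=(V,A)$ be a DAG with a weight function $\pi:V\to\mathbb{Z}_{\ge0}$ (not necessarily monotone), let $P=\{C_1,\dots,C_p\}$ be a chain partition of $D$, and let $T=(N_1,\dots,N_{\mathrm{wdt}(D)})$ be a tower of antichains of $D$. Then $\Pi(P)\ge \mathrm{val}(T)$.
   Context: $D^t$ is the transitive closure of $D$: arc $(u,v)$ iff there is a directed path with at least one arc from $u$ to $v$ in $D$. A chain is a sequence of vertices $(v_1,\dots,v_t)$ with $(v_i,v_{i+1})$ an arc of $D^t$ for all $i$ (also regarded as a vertex set). A chain partition is a family of vertex-disjoint chains covering every vertex exactly once. The price of a chain $C$ is $\Pi(C)=\max_{v\in C}\pi_v$, and of a chain partition $P$ is $\Pi(P)=\sum_{C\in P}\Pi(C)$. An antichain is a set of vertices pairwise non-adjacent in $D^t$; $\mathrm{wdt}(D)$ is the maximum size of an antichain. A tower of antichains is a sequence $(N_1,\dots,N_{\mathrm{wdt}(D)})$ of antichains with $|N_i|=i$. The value of an antichain is $\mathrm{val}(N)=\min_{v\in N}\pi_v$ and of a tower $T$ is $\mathrm{val}(T)=\sum_i\mathrm{val}(N_i)$. -}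

module Defs where

open import Data.Nat using (ℕ; _⊔_; _⊓_; _≤_; suc)
open import Data.Bool using (Bool; T)
open import Data.Fin using (Fin; toℕ)
open import Data.List using (List; []; _∷_; map; foldr; length; concat; allFin)
open import Data.Nat.ListAction using (sum)
open import Data.List.Relation.Unary.All using (All)
open import Data.List.Relation.Unary.Linked using (Linked)
open import Data.List.Relation.Unary.Unique.Propositional using (Unique)
open import Data.List.Membership.Propositional using (_∈_)
open import Data.List.Relation.Binary.Permutation.Propositional using (_↭_)
open import Relation.Binary.Construct.Closure.Transitive using (TransClosure)
open import Relation.Binary.PropositionalEquality using (_≡_)
open import Relation.Nullary using (¬_)
open import Data.Product using (Σ; _×_)

Digraph : ℕ → Set
Digraph n = Fin n → Fin n → Bool

module _ {n : ℕ} (D : Digraph n) where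

  Arc : Fin n → Fin n → Set
  Arc u v = T (D u v)

  ArcT : Fin n → Fin n → Set
  ArcT = TransClosure Arc

  IsDAG : Set
  IsDAG = ∀ v → ¬ ArcT v v

  IsChain : List (Fin n) → Set
  IsChain [] = Data.Empty.⊥ where import Data.Empty
  IsChain (v ∷ vs) = Linked ArcT (v ∷ vs)

  IsChainPartition : List (List (Fin n)) → Set
  IsChainPartition P = All IsChain P × (concat P ↭ allFin n)

  IsAntichain : List (Fin n) → Set
  IsAntichain N = Unique N × (∀ {u v} → u ∈ N → v ∈ N → ¬ ArcT u v)

  IsWidth : ℕ → Set
  IsWidth w = Σ (List (Fin n)) (λ N → IsAntichain N × length N ≡ w)
              × (∀ N → IsAntichain N → length N ≤ w)

  IsTower : (w : ℕ) → (Fin w → List (Fin n)) → Set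
  IsTower w Tw = ∀ i → IsAntichain (Tw i) × length (Tw i) ≡ suc (toℕ i)

module _ {n : ℕ} (π : Fin n → ℕ) where

  -- price of a chain: max of π over it (π ≥ 0, chains nonempty)
  priceChain : List (Fin n) → ℕ
  priceChain C = foldr (λ v m → π v ⊔ m) 0 C

  pricePartition : List (List (Fin n)) → ℕ
  pricePartition P = sum (map priceChain P)

  valAntichain : List (Fin n) → ℕ
  valAntichain [] = 0
  valAntichain (x ∷ xs) = foldr (λ v m → π v ⊓ m) (π x) xs

  valTower : (w : ℕ) → (Fin w → List (Fin n)) → ℕ
  valTower w Tw = sum (map (λ i → valAntichain (Tw i)) (allFin w))

-- Every vertex of an antichain N_i lies on its own chain of P, and the price of that chain is at
-- least val(N_i); so for each i at least i chains have price ≥ val(N_i). Matching N_1, N_2, …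
-- greedily against distinct chains of large enough price then gives Σ val(N_i) ≤ Σ Π(C).
module Submission where

open import Defs
open import Data.Nat using (ℕ; zero; suc; _+_; _⊓_; _≤_; _≤?_; z≤n; s≤s)
open import Data.Nat.Properties
open import Data.Nat.ListAction using (sum)
open import Data.Nat.ListAction.Properties using (sum-↭)
open import Data.Fin as Fin using (Fin; toℕ)
open import Data.Fin.Properties using () renaming (_≟_ to _≟ᶠ_)
open import Data.List using (List; []; _∷_; _++_; foldr; map; length; concat; filter; tabulate)
open import Data.List.Properties using (map-tabulate; filter-none; filter-accept; filter-reject)
open import Data.List.Relation.Unary.All as All using (All; _∷_)
import Data.List.Relation.Unary.All.Properties as All
open import Data.List.Relation.Unary.Any using (here; there)
open import Data.List.Relation.Unary.Linked as Linked using (Linked; _∷_)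
open import Data.List.Relation.Unary.AllPairs using (_∷_)
import Data.List.Relation.Unary.Unique.Propositional.Properties as Unique
open import Data.List.Membership.Propositional using (_∈_)
open import Data.List.Membership.Propositional.Properties using (∈-filter⁻; ∈-++⁻; ∈-∃++; ∈-allFin)
open import Data.List.Relation.Binary.Subset.Propositional using (_⊆_)
open import Data.List.Relation.Binary.Permutation.Propositional using (_↭_; ↭-sym)
open import Data.List.Relation.Binary.Permutation.Propositional.Properties
  using (↭-length; filter-↭; shift; ∈-resp-↭)
open import Relation.Binary.Construct.Closure.Transitive using () renaming (_++_ to _⁺++_)
open import Relation.Binary.PropositionalEquality using (_≡_; _≢_; refl; sym; trans; cong; subst)
open import Relation.Nullary using (¬_; yes; no; does)
open import Data.Bool using (true; false)
open import Relation.Unary using (Pred; Decidable)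
open import Relation.Unary.Properties using (∁?)
open import Data.Empty using (⊥-elim)
open import Data.Sum using (_⊎_; inj₁; inj₂)
open import Data.Product using (∃; _×_; _,_; proj₁; proj₂)
open import Function using (id; _∘_)

count≥ : ℕ → List ℕ → ℕ
count≥ t = length ∘ filter (t ≤?_)

count≥-accept : ∀ {t x} xs → t ≤ x → count≥ t (x ∷ xs) ≡ suc (count≥ t xs)
count≥-accept {t} _ t≤x = cong length (filter-accept (t ≤?_) t≤x)

count≥-reject : ∀ {t x} xs → ¬ t ≤ x → count≥ t (x ∷ xs) ≡ count≥ t xs
count≥-reject {t} _ t≰x = cong length (filter-reject (t ≤?_) t≰x)

count≥-∷ : ∀ t x xs → count≥ t (x ∷ xs) ≤ suc (count≥ t xs)
count≥-∷ t x xs with t ≤? x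
... | yes t≤x = ≤-reflexive (count≥-accept xs t≤x)
... | no t≰x  = ≤-trans (≤-reflexive (count≥-reject xs t≰x)) (n≤1+n _)

count≥-↭ : ∀ t {xs ys} → xs ↭ ys → count≥ t xs ≡ count≥ t ys
count≥-↭ t = ↭-length ∘ filter-↭ (t ≤?_)

count≥-witness : ∀ {t xs} → 1 ≤ count≥ t xs → ∃ λ x → x ∈ xs × t ≤ x
count≥-witness {t} {xs} positive with filter (t ≤?_) xs in eq
... | x ∷ _ = x , ∈-filter⁻ (t ≤?_) (subst (x ∈_) (sym eq) (here refl))

∈⇒↭∷ : ∀ {A : Set} {x : A} {xs} → x ∈ xs → ∃ λ ys → xs ↭ x ∷ ys
∈⇒↭∷ x∈xs with ys , zs , refl ← ∈-∃++ x∈xs = ys ++ zs , shift _ ys zs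

-- Greedy matching: g 0 is paid for by some c ≥ g 0, and removing c costs every count at most one.
count≥⇒sum-tabulate≤sum : ∀ w (g : Fin w → ℕ) cs →
  (∀ i → suc (toℕ i) ≤ count≥ (g i) cs) → sum (tabulate g) ≤ sum cs
count≥⇒sum-tabulate≤sum zero    g cs enough = z≤n
count≥⇒sum-tabulate≤sum (suc w) g cs enough
  with c , c∈cs , g₀≤c ← count≥-witness {xs = cs} (enough Fin.zero)
  with rest , cs↭c∷rest ← ∈⇒↭∷ c∈cs = begin
    g Fin.zero + sum (tabulate (g ∘ Fin.suc))
      ≤⟨ +-mono-≤ g₀≤c (count≥⇒sum-tabulate≤sum w (g ∘ Fin.suc) rest enough-rest) ⟩
    c + sum rest
      ≡⟨ sum-↭ (↭-sym cs↭c∷rest) ⟩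
    sum cs ∎
  where
  open ≤-Reasoning
  enough-rest : ∀ i → suc (toℕ i) ≤ count≥ (g (Fin.suc i)) rest
  enough-rest i = ≤-pred (≤-trans (enough (Fin.suc i))
    (≤-trans (≤-reflexive (count≥-↭ (g (Fin.suc i)) cs↭c∷rest)) (count≥-∷ _ c rest)))

length-filter-∁ : ∀ {A : Set} {p} {P : Pred A p} (P? : Decidable P) xs →
  length xs ≡ length (filter P? xs) + length (filter (∁? P?) xs)
length-filter-∁ P? []       = refl
length-filter-∁ P? (x ∷ xs) with does (P? x)
... | true  = cong suc (length-filter-∁ P? xs)
... | false = trans (cong suc (length-filter-∁ P? xs)) (sym (+-suc _ _))

module _ {n : ℕ} (D : Digraph n) where

  IsChain⇒Linked : ∀ {C} → IsChain D C → Linked (ArcT D) C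
  IsChain⇒Linked {_ ∷ _} chain = chain

  Linked⇒ArcT : ∀ {x y xs} → Linked (ArcT D) (x ∷ xs) → y ∈ xs → ArcT D x y
  Linked⇒ArcT (x<z ∷ _)  (here refl)  = x<z
  Linked⇒ArcT (x<z ∷ zs) (there y∈xs) = x<z ⁺++ Linked⇒ArcT zs y∈xs

  Linked⇒comparable : ∀ {xs x y} → Linked (ArcT D) xs → x ∈ xs → y ∈ xs → x ≢ y →
                      ArcT D x y ⊎ ArcT D y x
  Linked⇒comparable chain (here refl)  (here refl)  x≢y = ⊥-elim (x≢y refl)
  Linked⇒comparable chain (here refl)  (there y∈xs) _   = inj₁ (Linked⇒ArcT chain y∈xs)
  Linked⇒comparable chain (there x∈xs) (here refl)  _   = inj₂ (Linked⇒ArcT chain x∈xs)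
  Linked⇒comparable chain (there x∈xs) (there y∈xs) x≢y =
    Linked⇒comparable (Linked.tail chain) x∈xs y∈xs x≢y

  IsAntichain-filter : ∀ {p} {P : Pred (Fin n) p} (P? : Decidable P) {N} →
                       IsAntichain D N → IsAntichain D (filter P? N)
  IsAntichain-filter P? (unique , independent) =
    Unique.filter⁺ P? unique ,
    λ u∈ v∈ → independent (proj₁ (∈-filter⁻ P? u∈)) (proj₁ (∈-filter⁻ P? v∈))

  chain∩antichain≤1 : ∀ {C N} → Linked (ArcT D) C → IsAntichain D N → N ⊆ C → length N ≤ 1
  chain∩antichain≤1 {N = []}    _ _ _ = z≤n
  chain∩antichain≤1 {N = _ ∷ []} _ _ _ = s≤s z≤n
  chain∩antichain≤1 {N = x ∷ y ∷ _} chain ((x≢y ∷ _) ∷ _ , independent) N⊆C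
    with Linked⇒comparable chain (N⊆C (here refl)) (N⊆C (there (here refl))) x≢y
  ... | inj₁ x<y = ⊥-elim (independent (here refl) (there (here refl)) x<y)
  ... | inj₂ y<x = ⊥-elim (independent (there (here refl)) (here refl) y<x)

module _ {n : ℕ} (π : Fin n → ℕ) where

  π≤priceChain : ∀ {v C} → v ∈ C → π v ≤ priceChain π C
  π≤priceChain {C = x ∷ _} (here refl)  = m≤m⊔n (π x) _
  π≤priceChain {C = x ∷ _} (there v∈C) = ≤-trans (π≤priceChain v∈C) (m≤n⊔m (π x) _)

  min-fold : ℕ → List (Fin n) → ℕ
  min-fold = foldr (λ v m → π v ⊓ m)

  min-fold≤seed : ∀ a xs → min-fold a xs ≤ a
  min-fold≤seed a []       = ≤-refl
  min-fold≤seed a (x ∷ xs) = ≤-trans (m⊓n≤n (π x) _) (min-fold≤seed a xs)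

  min-fold≤π : ∀ a {v xs} → v ∈ xs → min-fold a xs ≤ π v
  min-fold≤π a {xs = x ∷ _}  (here refl)  = m⊓n≤m (π x) _
  min-fold≤π a {xs = x ∷ xs} (there v∈xs) = ≤-trans (m⊓n≤n (π x) _) (min-fold≤π a v∈xs)

  valAntichain≤π : ∀ {v N} → v ∈ N → valAntichain π N ≤ π v
  valAntichain≤π {N = x ∷ xs} (here refl)  = min-fold≤seed (π x) xs
  valAntichain≤π {N = x ∷ xs} (there v∈xs) = min-fold≤π (π x) v∈xs

  -- Each chain of Q contributes at most one vertex of N, and only if its price reaches t.
  antichain≤count≥ : ∀ {D : Digraph n} t Q → All (Linked (ArcT D)) Q →
    ∀ {N} → IsAntichain D N → N ⊆ concat Q → All (λ v → t ≤ π v) N →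
    length N ≤ count≥ t (map (priceChain π) Q)
  antichain≤count≥ t []      _ {[]}    _ _     _ = z≤n
  antichain≤count≥ t []      _ {_ ∷ _} _ N⊆[] _ with () ← N⊆[] (here refl)
  antichain≤count≥ {D} t (C ∷ Q) (chain ∷ chains) {N} antichain N⊆C++Q large = begin
    length N                                  ≡⟨ length-filter-∁ (_∈? C) N ⟩
    length onC + length offC                  ≤⟨ +-monoʳ-≤ (length onC) offC-bound ⟩
    length onC + count≥ t prices              ≤⟨ onC-share ⟩
    count≥ t (priceChain π C ∷ prices)        ∎
    where
    open ≤-Reasoning
    open import Data.List.Membership.DecPropositional (_≟ᶠ_ {n}) using (_∈?_)
    prices : List ℕ
    prices = map (priceChain π) Q
    onC offC : List (Fin n)
    onC  = filter (_∈? C) N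
    offC = filter (∁? (_∈? C)) N

    offC⊆Q : offC ⊆ concat Q
    offC⊆Q v∈offC with v∈N , v∉C ← ∈-filter⁻ (∁? (_∈? C)) {xs = N} v∈offC
      with ∈-++⁻ C (N⊆C++Q v∈N)
    ... | inj₁ v∈C = ⊥-elim (v∉C v∈C)
    ... | inj₂ v∈Q = v∈Q

    offC-bound : length offC ≤ count≥ t prices
    offC-bound = antichain≤count≥ t Q chains (IsAntichain-filter D (∁? (_∈? C)) antichain)
                   offC⊆Q (All.filter⁺ (∁? (_∈? C)) large)

    onC-share : length onC + count≥ t prices ≤ count≥ t (priceChain π C ∷ prices)
    onC-share with t ≤? priceChain π C
    ... | yes t≤c = begin
      length onC + count≥ t prices  ≤⟨ +-monoˡ-≤ _ (chain∩antichain≤1 D chain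
                                          (IsAntichain-filter D (_∈? C) antichain)
                                          (λ v∈onC → proj₂ (∈-filter⁻ (_∈? C) {xs = N} v∈onC))) ⟩
      suc (count≥ t prices)          ≡⟨ count≥-accept prices t≤c ⟨
      count≥ t (priceChain π C ∷ prices) ∎
    ... | no t≰c = begin
      length onC + count≥ t prices  ≡⟨ cong (λ L → length L + count≥ t prices) onC≡[] ⟩
      count≥ t prices                ≡⟨ count≥-reject prices t≰c ⟨
      count≥ t (priceChain π C ∷ prices) ∎
      where
      onC≡[] : onC ≡ []
      onC≡[] = filter-none (_∈? C)
        (All.map (λ t≤πv v∈C → t≰c (≤-trans t≤πv (π≤priceChain v∈C))) large)

lemma3 : (n : ℕ) (D : Digraph n) → IsDAG D → (π : Fin n → ℕ)
    → (P : List (List (Fin n))) → IsChainPartition D P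
    → (w : ℕ) → IsWidth D w
    → (Tw : Fin w → List (Fin n)) → IsTower D w Tw
    → valTower π w Tw ≤ pricePartition π P
lemma3 _ D _ π P (chains , P↭V) w _ Tw tower = begin
  valTower π w Tw             ≡⟨ cong sum (map-tabulate id val) ⟩
  sum (tabulate val)          ≤⟨ count≥⇒sum-tabulate≤sum w val (map (priceChain π) P) enough ⟩
  pricePartition π P          ∎
  where
  open ≤-Reasoning
  val : Fin w → ℕ
  val i = valAntichain π (Tw i)

  every-vertex-covered : ∀ {vs} → vs ⊆ concat P
  every-vertex-covered {x = v} _ = ∈-resp-↭ (↭-sym P↭V) (∈-allFin v)

  enough : ∀ i → suc (toℕ i) ≤ count≥ (val i) (map (priceChain π) P)
  enough i with antichain , size ← tower i =
    subst (_≤ count≥ (val i) (map (priceChain π) P)) size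
      (antichain≤count≥ π (val i) P (All.map (IsChain⇒Linked D) chains)
         antichain every-vertex-covered (All.tabulate (valAntichain≤π π)))
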